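{- For every continuation $K$ and every base computation $C$, $\underline{K}[\overline{C}]=\overline{C[k:=K]}$.
   Context: Syntax. Fix a ring of scalars; $\alpha$ ranges over it. Terms: $M,N ::= V \mid MN \mid \alpha.M \mid M+N$; values $V,W ::= B \mid 0 \mid \alpha.V \mid V+W$; base values $B ::= x \mid \lambda x.M$. Terms are taken up to $\alpha$-conversion and $M[x:=N]$ is capture-avoiding substitution. CPS grammar. Base computations $C ::= KB \mid B_1B_2K \mid TK$; computation combinations $D ::= C \mid 0 \mid \alpha.D \mid D_1+D_2$; base suspensions $S ::= \lambda k.C$; suspension combinations $T ::= S \mid 0\mid \alpha.T \mid T_1+T_2$; continuations $K ::= k \mid \lambda b.BbK \mid \lambda b_1.T(\lambda b_2.b_1b_2K)$; CPS-values $B ::= x \mid \lambda x.S$. Here $k,b,b_1,b_2$ are reserved variables distinct from ordinary variables $x$; $k$ occurs only as the continuation $k$ and as the binder in $\lambda k.C$; $b,b_1,b_2$ occur only where displayed. Inverse translation: $\overline{KB}=\underline{K}[\psi(B)]$; $\overline{B_1B_2K}=\underline{K}[\psi(B_1)\psi(B_2)]$; $\overline{TK}=\underline{K}[\sigma(T)]$; $\overline{0}=0$; $\overline{\alpha.D}=\alpha.\overline{D}$; $\overline{D_1+D_2}=\overline{D_1}+\overline{D_2}$; $\sigma(\lambda k.C)=\overline{C}$; $\sigma(0)=0$; $\sigma(\alpha.T)=\alpha.\sigma(T)$; $\sigma(T_1+T_2)=\sigma(T_1)+\sigma(T_2)$; $\psi(x)=x$; $\psi(\lambda x.S)=\lambda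 x.\sigma(S)$; for a term $M$: $\underline{k}[M]=M$; $\underline{\lambda b.BbK}[M]=\underline{K}[\psi(B)M]$; $\underline{\lambda b_1.T(\lambda b_2.b_1b_2K)}[M]=\underline{K}[M\,\sigma(T)]$. -}

module Defs where

open import Data.Nat using (ℕ)
open import Level using (Level)

private variable a : Level

-- Ordinary variables x are de Bruijn indices, so
-- syntactic equality of terms is exactly equality up to α-conversion.

-- Source terms  M,N ::= x | λx.M | 0 | MN | α.M | M+N
-- (values V ::= B | 0 | α.V | V+W, B ::= x | λx.M are subsets of these)

data Term (Sc : Set a) : Set a where
  var  : ℕ → Term Sc
  lam  : Term Sc → Term Sc
  zer  : Term Sc
  app  : Term Sc → Term Sc → Term Sc
  scl  : Sc → Term Sc → Term Sc
  pls  : Term Sc → Term Sc → Term Sc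

-- The reserved variables k, b, b₁, b₂ are not ordinary
-- variables: `k` is the constructor `kk` of continuations (referring to the
-- nearest enclosing λk), and b, b₁, b₂ only occur where displayed, so they
-- are built into the shapes of the continuation constructors.
--
--   C ::= K B | B₁ B₂ K | T K               (BComp)
--   D ::= C | 0 | α.D | D₁ + D₂             (Comp)
--   S ::= λk.C                              (BSusp)
--   T ::= S | 0 | α.T | T₁ + T₂             (Susp)
--   K ::= k | λb.B b K | λb₁.T(λb₂.b₁ b₂ K)  (Cont)
--   B ::= x | λx.S                          (CVal)

mutual
  data CVal (Sc : Set a) : Set a where
    cvar : ℕ → CVal Sc
    clam : BSusp Sc → CVal Sc

  data BSusp (Sc : Set a) : Set a where
    klam : BComp Sc → BSusp Sc

  data Susp (Sc : Set a) : Set a where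
    sbase : BSusp Sc → Susp Sc
    szer  : Susp Sc
    sscl  : Sc → Susp Sc → Susp Sc
    spls  : Susp Sc → Susp Sc → Susp Sc

  data BComp (Sc : Set a) : Set a where
    kapp : Cont Sc → CVal Sc → BComp Sc
    bapp : CVal Sc → CVal Sc → Cont Sc → BComp Sc
    tapp : Susp Sc → Cont Sc → BComp Sc

  data Comp (Sc : Set a) : Set a where
    cbase : BComp Sc → Comp Sc
    czer  : Comp Sc
    cscl  : Sc → Comp Sc → Comp Sc
    cpls  : Comp Sc → Comp Sc → Comp Sc

  data Cont (Sc : Set a) : Set a where
    kk   : Cont Sc
    kfun : CVal Sc → Cont Sc → Cont Sc
    ksus : Susp Sc → Cont Sc → Cont Sc

-- Free occurrences of k in a base computation C are only in its outermost
-- continuation (every other k is bound by some λk inside a CVal/Susp), and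
-- no ordinary binder lies above them, so no capture/shifting can occur.

module _ {Sc : Set a} where

  substK : Cont Sc → Cont Sc → Cont Sc
  substK kk         K' = K'
  substK (kfun B K) K' = kfun B (substK K K')
  substK (ksus T K) K' = ksus T (substK K K')

  substC : BComp Sc → Cont Sc → BComp Sc
  substC (kapp K B)     K' = kapp (substK K K') B
  substC (bapp B₁ B₂ K) K' = bapp B₁ B₂ (substK K K')
  substC (tapp T K)     K' = tapp T (substK K K')

  mutual
    bar : BComp Sc → Term Sc
    bar (kapp K B)     = plug K (ψ B)
    bar (bapp B₁ B₂ K) = plug K (app (ψ B₁) (ψ B₂))
    bar (tapp T K)     = plug K (σ T)

    σ₀ : BSusp Sc → Term Sc
    σ₀ (klam C) = bar C

    σ : Susp Sc → Term Sc
    σ (sbase S)   = σ₀ S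
    σ szer        = zer
    σ (sscl a T)  = scl a (σ T)
    σ (spls T T') = pls (σ T) (σ T')

    ψ : CVal Sc → Term Sc
    ψ (cvar x) = var x
    ψ (clam S) = lam (σ₀ S)

    plug : Cont Sc → Term Sc → Term Sc
    plug kk         M = M
    plug (kfun B K) M = plug K (app (ψ B) M)
    plug (ksus T K) M = plug K (app M (σ T))

  barD : Comp Sc → Term Sc
  barD (cbase C)   = bar C
  barD czer        = zer
  barD (cscl a D)  = scl a (barD D)
  barD (cpls D D') = pls (barD D) (barD D')

module Submission where

-- A base computation C has the shape K₀ H, where K₀ is its
-- outermost continuation and H is its "head" (a value B, an application
-- B₁ B₂, or a suspension combination T); its inverse translation is the
-- head's translation plugged into K₀, and C[k:=K] just replaces K₀ by
-- K₀[k:=K].  So the theorem reduces to one fact about continuations: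
-- plugging into K₀ and then into K is plugging into the composite
-- continuation K₀[k:=K].

open import Defs
open import Algebra.Bundles using (Ring)
open import Relation.Binary.PropositionalEquality using (_≡_; refl; cong)
open Relation.Binary.PropositionalEquality.≡-Reasoning

module _ {a} {Sc : Set a} where

  plug-substK : (K K' : Cont Sc) (M : Term Sc) →
    plug K' (plug K M) ≡ plug (substK K K') M
  plug-substK kk         K' M = refl
  plug-substK (kfun B K) K' M = plug-substK K K' (app (ψ B) M)
  plug-substK (ksus T K) K' M = plug-substK K K' (app M (σ T))

  -- The outermost continuation of a base computation: the only place
  -- where k occurs free.
  continuation : BComp Sc → Cont Sc
  continuation (kapp K B)     = K
  continuation (bapp B₁ B₂ K) = K
  continuation (tapp T K)     = K

  head : BComp Sc → Term Sc
  head (kapp K B)     = ψ B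
  head (bapp B₁ B₂ K) = app (ψ B₁) (ψ B₂)
  head (tapp T K)     = σ T

  bar-decompose : (C : BComp Sc) → bar C ≡ plug (continuation C) (head C)
  bar-decompose (kapp K B)     = refl
  bar-decompose (bapp B₁ B₂ K) = refl
  bar-decompose (tapp T K)     = refl

  head-substC : (C : BComp Sc) (K : Cont Sc) → head (substC C K) ≡ head C
  head-substC (kapp K₀ B)     K = refl
  head-substC (bapp B₁ B₂ K₀) K = refl
  head-substC (tapp T K₀)     K = refl

  continuation-substC : (C : BComp Sc) (K : Cont Sc) →
    continuation (substC C K) ≡ substK (continuation C) K
  continuation-substC (kapp K₀ B)     K = refl
  continuation-substC (bapp B₁ B₂ K₀) K = refl
  continuation-substC (tapp T K₀)     K = refl

lemma3p10 : ∀ {c ℓ} (R : Ring c ℓ) (K : Cont (Ring.Carrier R)) (C : BComp (Ring.Carrier R)) →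
    plug K (bar C) ≡ bar (substC C K)
lemma3p10 R K C = begin
  plug K (bar C)
    ≡⟨ cong (plug K) (bar-decompose C) ⟩
  plug K (plug (continuation C) (head C))
    ≡⟨ plug-substK (continuation C) K (head C) ⟩
  plug (substK (continuation C) K) (head C)
    ≡⟨ cong (λ K₀ → plug K₀ (head C)) (continuation-substC C K) ⟨
  plug (continuation (substC C K)) (head C)
    ≡⟨ cong (plug (continuation (substC C K))) (head-substC C K) ⟨
  plug (continuation (substC C K)) (head (substC C K))
    ≡⟨ bar-decompose (substC C K) ⟨
  bar (substC C K)
    ∎
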